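{- Let $A,B$ be process templates and consider conjunctive systems. For every $n \geq 2$ and every $\mathrm{LTL}\setminus\mathsf{X}$ formula $h(A,B_1)$: if $(A,B)^{(1,n)}$ has an unconditionally-fair initializing run satisfying $h(A,B_1)$, then $(A,B)^{(1,n+1)}$ has an unconditionally-fair initializing run satisfying $h(A,B_1)$.
   Context: A process template is $U=(Q_U,\mathrm{init}_U,\Sigma_U,\delta_U)$ with finite state set $Q_U$ containing initial state $\mathrm{init}_U$, finite input alphabet $\Sigma_U$, and guarded transition relation $\delta_U \subseteq Q_U \times \Sigma_U \times \mathcal{P}(Q_A \cup Q_B) \times Q_U$. $Q_A,Q_B$ are disjoint, as are $\Sigma_A,\Sigma_B$. The system $(A,B)^{(1,n)}$ consists of one copy $A$ of template $A$ and $n$ copies $B_1,\dots,B_n$ of $B$ in interleaving composition, starting with all processes in their initial states. A local transition $(q,\sigma,g,q')$ of process $p$ is enabled in global state $s$ with global input $e$ if $s(p)=q$, $e(p)=\sigma$ and (conjunctive interpretation) every process $p'\neq p$ has $s(p')\in g$; $\mathrm{init}_A,\mathrm{init}_B$ belong to every guard. Each global step moves exactly one process along an enabled local transition. A run is a maximal sequence of configurations $(s_t,e_t,p_t)$ from the initial state ($p_t$ the moving process; a $\bot$ configuration occurs exactly when all processes are disabled, ending the run), in which a process's input changes only when that process moves. A run is unconditionally-fair if every process moves infinitely often, and initializing if every process that moves infinitely often visits its initial state infinitely often. $h(A,B_1)$ is an LTL formula without next-time over propositions from $Q_A\cup\Sigma_A$ and from $Q_B\cup\Sigma_B$ indexed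 by $B_1$, evaluated on the local states and inputs of $A$ and $B_1$. -}

module Defs where

open import Data.Nat using (ℕ; zero; suc; _≤_; s≤s; z≤n)
open import Data.Fin using (Fin)
open import Data.Bool using (Bool; true)
open import Data.Sum using (_⊎_; inj₁; inj₂)
open import Data.Unit using (⊤; tt)
open import Data.Product using (_×_; _,_; ∃; ∃-syntax; Σ-syntax)
open import Data.List using (List)
open import Data.List.Membership.Propositional using (_∈_)
open import Relation.Binary.PropositionalEquality using (_≡_; _≢_)
open import Relation.Nullary using (¬_)

Guard : ℕ → ℕ → Set
Guard a b = Fin a ⊎ Fin b → Bool

record Templates : Set where
  field
    QA ΣA QB ΣB : ℕ
    initA : Fin QA
    initB : Fin QB
    δA : List (Fin QA × Fin ΣA × Guard QA QB × Fin QA)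
    δB : List (Fin QB × Fin ΣB × Guard QA QB × Fin QB)
    δA-init : ∀ {q σ g q'} → (q , σ , g , q') ∈ δA → g (inj₁ initA) ≡ true × g (inj₂ initB) ≡ true
    δB-init : ∀ {q σ g q'} → (q , σ , g , q') ∈ δB → g (inj₁ initA) ≡ true × g (inj₂ initB) ≡ true

module _ (T : Templates) where
  open Templates T

  -- processes of (A,B)^(1,n): A is inj₁ tt, B_i is inj₂ i
  Proc : ℕ → Set
  Proc n = ⊤ ⊎ Fin n

  record GState (n : ℕ) : Set where
    constructor gstate
    field
      sA : Fin QA
      sB : Fin n → Fin QB

  record GInput (n : ℕ) : Set where
    constructor ginput
    field
      eA : Fin ΣA
      eB : Fin n → Fin ΣB

  open GState
  open GInput

  loc : ∀ {n} → GState n → Proc n → Fin QA ⊎ Fin QB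
  loc s (inj₁ _) = inj₁ (sA s)
  loc s (inj₂ i) = inj₂ (sB s i)

  inp : ∀ {n} → GInput n → Proc n → Fin ΣA ⊎ Fin ΣB
  inp e (inj₁ _) = inj₁ (eA e)
  inp e (inj₂ i) = inj₂ (eB e i)

  initOf : ∀ {n} → Proc n → Fin QA ⊎ Fin QB
  initOf (inj₁ _) = inj₁ initA
  initOf (inj₂ _) = inj₂ initB

  Step : ∀ {n} → GState n → GInput n → Proc n → GState n → Set
  Step {n} s e p s' =
    ∃[ q ] ∃[ σ ] ∃[ g ] ∃[ q' ] (
      LocalTrans p q σ g q'
      × loc s p ≡ q × inp e p ≡ σ
      × (∀ p' → p' ≢ p → g (loc s p') ≡ true)
      × loc s' p ≡ q'
      × (∀ p' → p' ≢ p → loc s' p' ≡ loc s p'))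
    where
    LocalTrans : Proc n → Fin QA ⊎ Fin QB → Fin ΣA ⊎ Fin ΣB → Guard QA QB → Fin QA ⊎ Fin QB → Set
    LocalTrans (inj₁ _) (inj₁ q) (inj₁ σ) g (inj₁ q') = (q , σ , g , q') ∈ δA
    LocalTrans (inj₂ _) (inj₂ q) (inj₂ σ) g (inj₂ q') = (q , σ , g , q') ∈ δB
    LocalTrans _ _ _ _ _ = Data.Empty.⊥
      where import Data.Empty

  -- An infinite run of (A,B)^(1,n): configurations (s_t , e_t , p_t).
  -- (Unconditionally-fair runs are necessarily infinite, so finite runs
  -- ending in a ⊥ configuration need not be represented.)
  record Run (n : ℕ) : Set where
    field
      st : ℕ → GState n
      ev : ℕ → GInput n
      mv : ℕ → Proc n
      start : ∀ p → loc (st 0) p ≡ initOf p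
      step  : ∀ t → Step (st t) (ev t) (mv t) (st (suc t))
      input : ∀ t p → p ≢ mv t → inp (ev (suc t)) p ≡ inp (ev t) p

  open Run

  MovesInfOften : ∀ {n} → Run n → Proc n → Set
  MovesInfOften r p = ∀ t → ∃[ t' ] (t ≤ t' × mv r t' ≡ p)

  UncondFair : ∀ {n} → Run n → Set
  UncondFair r = ∀ p → MovesInfOften r p

  Initializing : ∀ {n} → Run n → Set
  Initializing r = ∀ p → MovesInfOften r p →
    ∀ t → ∃[ t' ] (t ≤ t' × loc (st r t') p ≡ initOf p)

  data LTL : Set where
    stateA : Fin QA → LTL
    inputA : Fin ΣA → LTL
    stateB₁ : Fin QB → LTL
    inputB₁ : Fin ΣB → LTL
    true' : LTL
    not' : LTL → LTL
    _and'_ : LTL → LTL → LTL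
    _until'_ : LTL → LTL → LTL

  Sat : ∀ {n} → Run n → Fin n → ℕ → LTL → Set
  Sat r b₁ t (stateA q) = sA (st r t) ≡ q
  Sat r b₁ t (inputA σ) = eA (ev r t) ≡ σ
  Sat r b₁ t (stateB₁ q) = sB (st r t) b₁ ≡ q
  Sat r b₁ t (inputB₁ σ) = eB (ev r t) b₁ ≡ σ
  Sat r b₁ t true' = ⊤
  Sat r b₁ t (not' φ) = ¬ Sat r b₁ t φ
  Sat r b₁ t (φ and' ψ) = Sat r b₁ t φ × Sat r b₁ t ψ
  Sat r b₁ t (φ until' ψ) =
    ∃[ k ] (t ≤ k × Sat r b₁ k ψ × (∀ j → t ≤ j → Data.Nat._<_ j k → Sat r b₁ j φ))

B₁ : ∀ {n} → 2 ≤ n → Fin n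
B₁ (s≤s _) = Fin.zero
  where import Data.Fin as Fin

-- Split the trajectory of B₂ into its excursions from init_B (maximal pieces
-- ending with a move of B₂ back into init_B; fairness and the initializing
-- condition make these infinitely many) and hand the excursions alternately
-- to two copies of B₂.  While one copy plays B₂ the other rests in init_B,
-- which belongs to every guard, so under the conjunctive interpretation every
-- move of the original run stays enabled.  Each copy thus moves and returns
-- to init_B infinitely often, and A and B₁ see exactly the original trace, so
-- they satisfy the same LTL∖X formulas.

module Submission where

open import Defs
open import Data.Nat using (ℕ; zero; suc; _+_; _∸_; _≤_; _<_; z≤n; s≤s)
open import Data.Nat.Properties
  using ( m≤n⇒m≤1+n; ≤-refl; ≤-trans; ≤-pred; <⇒≤; <⇒≱; n≤1+n; n<1+n; m<n⇒m<1+n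
        ; m≤n⇒m<n∨m≡n; <-cmp; +-suc; m∸n+n≡m)
open import Data.Fin using (Fin) renaming (zero to fz; suc to fs)
open import Data.Fin.Properties using () renaming (_≟_ to _≟ᶠ_)
open import Data.Bool using (Bool; true; false; not; _xor_; if_then_else_)
open import Data.Bool.Properties using (¬-not) renaming (_≟_ to _≟ᵇ_)
open import Data.Sum using (_⊎_; inj₁; inj₂)
open import Data.Sum.Properties using (inj₂-injective; ≡-dec)
open import Data.Unit using (⊤) renaming (_≟_ to _≟ᵘ_)
open import Data.Product using (_×_; _,_; proj₁; proj₂; ∃-syntax)
open import Data.Product.Function.NonDependent.Propositional using (_×-⇔_)
open import Function using (_∘_; id; _⇔_; mk⇔; Equivalence)
open import Function.Related.TypeIsomorphisms using (¬-cong-⇔)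
open import Relation.Binary using (DecidableEquality; tri<; tri≈; tri>)
open import Relation.Binary.PropositionalEquality
open import Relation.Nullary using (¬_; yes; no; does; contradiction; _×-dec_)
open import Relation.Nullary.Decidable using (dec-true; dec-false)
open import Relation.Unary using (Decidable)

open Equivalence using (to; from)
open GState
open GInput
open Run

if-else-≡ : ∀ {X : Set} b {x y : X} → y ≡ x → (if b then x else y) ≡ x
if-else-≡ false y≡x = y≡x
if-else-≡ true _ = refl

if-xor-same : ∀ {X : Set} b {x y : X} → (if b xor b then x else y) ≡ y
if-xor-same false = refl
if-xor-same true = refl

if-not-xor-same : ∀ {X : Set} b {x y : X} → (if not b xor b then x else y) ≡ x
if-not-xor-same false = refl
if-not-xor-same true = refl

FirstFrom : (ℕ → Set) → ℕ → ℕ → Set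
FirstFrom P t e = t ≤ e × P e × (∀ j → t ≤ j → j < e → ¬ P j)

module _ {P : ℕ → Set} where

  FirstFrom-unique : ∀ {t a b} → FirstFrom P t a → FirstFrom P t b → a ≡ b
  FirstFrom-unique {a = a} {b} (t≤a , Pa , before-a) (t≤b , Pb , before-b) with <-cmp a b
  ... | tri< a<b _ _ = contradiction Pa (before-b a t≤a a<b)
  ... | tri≈ _ a≡b _ = a≡b
  ... | tri> _ _ b<a = contradiction Pb (before-a b t≤b b<a)

  FirstFrom-here : ∀ {t} → P t → FirstFrom P t t
  FirstFrom-here Pt = ≤-refl , Pt , λ j t≤j j<t → contradiction t≤j (<⇒≱ j<t)

  FirstFrom-pred : ∀ {t e} → ¬ P t → FirstFrom P (suc t) e → FirstFrom P t e
  FirstFrom-pred {t} {e} ¬Pt (t<e , Pe , before) = <⇒≤ t<e , Pe , before′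
    where
    before′ : ∀ j → t ≤ j → j < e → ¬ P j
    before′ j t≤j j<e with m≤n⇒m<n∨m≡n t≤j
    ... | inj₁ t<j = before j t<j j<e
    ... | inj₂ refl = ¬Pt

  module _ (P? : Decidable P) where

    firstFrom : ∀ {t w} → t ≤ w → P w → ∃[ e ] FirstFrom P t e
    firstFrom {t} {w} t≤w Pw = search (w ∸ t) t (subst P (sym (m∸n+n≡m t≤w)) Pw)
      where
      search : ∀ d t → P (d + t) → ∃[ e ] FirstFrom P t e
      search d t Pd+t with P? t
      ... | yes Pt = t , FirstFrom-here Pt
      search zero t Pt | no ¬Pt = contradiction Pt ¬Pt
      search (suc d) t Pd+t | no ¬Pt with search d (suc t) (subst P (sym (+-suc d t)) Pd+t)
      ... | e , first = e , FirstFrom-pred ¬Pt first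

    entry-step : ∀ {a b} → a ≤ b → ¬ P a → P b → ∃[ e ] (a ≤ e × ¬ P e × P (suc e))
    entry-step {b = zero} z≤n ¬Pa Pb = contradiction Pb ¬Pa
    entry-step {b = suc b} a≤1+b ¬Pa P1+b with m≤n⇒m<n∨m≡n a≤1+b
    ... | inj₂ refl = contradiction P1+b ¬Pa
    ... | inj₁ a<1+b with P? b
    ...   | yes Pb = entry-step (≤-pred a<1+b) ¬Pa Pb
    ...   | no ¬Pb = b , ≤-pred a<1+b , ¬Pb , P1+b

module Alternation {E : ℕ → Set} (E? : Decidable E) (E-inf : ∀ t → ∃[ e ] (t ≤ e × E e)) where

  parity : ℕ → Bool
  parity zero = false
  parity (suc t) = does (E? t) xor parity t

  parity-event : ∀ {t} → E t → parity (suc t) ≡ not (parity t)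
  parity-event {t} Et = cong (_xor parity t) (dec-true (E? t) Et)

  parity-quiet : ∀ {t} → ¬ E t → parity (suc t) ≡ parity t
  parity-quiet {t} ¬Et = cong (_xor parity t) (dec-false (E? t) ¬Et)

  parity-constant : ∀ {a b} → a ≤ b → (∀ j → a ≤ j → j < b → ¬ E j) → parity b ≡ parity a
  parity-constant {b = zero} z≤n quiet = refl
  parity-constant {a} {suc b} a≤1+b quiet with m≤n⇒m<n∨m≡n a≤1+b
  ... | inj₂ refl = refl
  ... | inj₁ a<1+b =
    trans (parity-quiet (quiet b (≤-pred a<1+b) (n<1+n b)))
          (parity-constant (≤-pred a<1+b) (λ j a≤j j<b → quiet j a≤j (m<n⇒m<1+n j<b)))

  private
    firstEvent : ∀ t → ∃[ e ] FirstFrom E t e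
    firstEvent t = let _ , t≤e , Ee = E-inf t in firstFrom E? t≤e Ee

  opaque
    nextEvent : ℕ → ℕ
    nextEvent t = proj₁ (firstEvent t)

    nextEvent-first : ∀ t → FirstFrom E t (nextEvent t)
    nextEvent-first t = proj₂ (firstEvent t)

  nextEvent-here : ∀ {t} → E t → nextEvent t ≡ t
  nextEvent-here Et = FirstFrom-unique (nextEvent-first _) (FirstFrom-here Et)

  nextEvent-quiet : ∀ {t} → ¬ E t → nextEvent (suc t) ≡ nextEvent t
  nextEvent-quiet ¬Et = FirstFrom-unique (FirstFrom-pred ¬Et (nextEvent-first _)) (nextEvent-first _)

  event-with-parity : ∀ b t → ∃[ e ] (t ≤ e × E e × parity e ≡ b)
  event-with-parity b t with nextEvent-first t | parity (nextEvent t) ≟ᵇ b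
  ... | t≤e , Ee , _ | yes parity≡b = nextEvent t , t≤e , Ee , parity≡b
  ... | t≤e , Ee , _ | no parity≢b with nextEvent-first (suc (nextEvent t))
  ...   | e<e′ , Ee′ , quiet = _ , ≤-trans t≤e (<⇒≤ e<e′) , Ee′ , (begin
    parity (nextEvent (suc e))  ≡⟨ parity-constant e<e′ quiet ⟩
    parity (suc e)              ≡⟨ parity-event Ee ⟩
    not (parity e)              ≡⟨ sym (¬-not (parity≢b ∘ sym)) ⟩
    b                           ∎)
    where
    open ≡-Reasoning
    e = nextEvent t

_≟ₚ_ : ∀ {n} → DecidableEquality (⊤ ⊎ Fin n)
_≟ₚ_ = ≡-dec _≟ᵘ_ _≟ᶠ_

module _ {T : Templates} where
  open Templates T

  Step-frame : ∀ {n} {s s′ : GState T n} {e p} → Step T s e p s′ →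
               ∀ p′ → p′ ≢ p → loc T s′ p′ ≡ loc T s p′
  Step-frame (_ , _ , _ , _ , _ , _ , _ , _ , _ , frame) = frame

  MirrorsOrRests : ∀ {n n′} → GState T n → Proc T n → GState T n′ → Proc T n′ → Set
  MirrorsOrRests s p S P′ =
    (∃[ p′ ] (p′ ≢ p × loc T S P′ ≡ loc T s p′)) ⊎ loc T S P′ ≡ initOf T P′

  private
    guard-transfer : ∀ {n n′} {s : GState T n} {p} {S : GState T n′} {P} (g : Guard QA QB) →
      g (inj₁ initA) ≡ true × g (inj₂ initB) ≡ true →
      (∀ p′ → p′ ≢ p → g (loc T s p′) ≡ true) →
      (∀ P′ → P′ ≢ P → MirrorsOrRests s p S P′) →
      ∀ P′ → P′ ≢ P → g (loc T S P′) ≡ true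
    guard-transfer g inits enabled mirrors P′ P′≢P with mirrors P′ P′≢P
    ... | inj₁ (p′ , p′≢p , same) = trans (cong g same) (enabled p′ p′≢p)
    ... | inj₂ resting = trans (cong g resting) (init-enabled P′)
      where
      init-enabled : ∀ P′ → g (initOf T P′) ≡ true
      init-enabled (inj₁ _) = proj₁ inits
      init-enabled (inj₂ _) = proj₂ inits

  step-transfer : ∀ {n n′} {s s′ : GState T n} {e p} {S S′ : GState T n′} {E P} →
    Step T s e p s′ →
    loc T S P ≡ loc T s p → loc T S′ P ≡ loc T s′ p → inp T E P ≡ inp T e p →
    (∀ P′ → P′ ≢ P → MirrorsOrRests s p S P′) →
    (∀ P′ → P′ ≢ P → loc T S′ P′ ≡ loc T S P′) →
    Step T S E P S′
  step-transfer {p = inj₁ _} {P = inj₁ _} (q , σ , g , inj₁ q′ , δ , refl , refl , enabled , moved , _)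
                before after input mirrors frame =
    q , σ , g , inj₁ q′ , δ , before , input , guard-transfer g (δA-init δ) enabled mirrors
      , trans after moved , frame
  step-transfer {p = inj₂ _} {P = inj₂ _} (q , σ , g , inj₂ q′ , δ , refl , refl , enabled , moved , _)
                before after input mirrors frame =
    q , σ , g , inj₂ q′ , δ , before , input , guard-transfer g (δB-init δ) enabled mirrors
      , trans after moved , frame
  step-transfer {p = inj₁ _} {P = inj₁ _} (_ , _ , _ , inj₂ _ , () , refl , refl , _)
  step-transfer {p = inj₂ _} {P = inj₂ _} (_ , _ , _ , inj₁ _ , () , refl , refl , _)
  step-transfer {p = inj₁ _} {P = inj₂ _} _ ()
  step-transfer {p = inj₂ _} {P = inj₁ _} _ ()

  record SameObservations {n n′} (r : Run T n) (b : Fin n) (r′ : Run T n′) (b′ : Fin n′) : Set where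
    field
      stateA-≡ : ∀ t → sA (st r t) ≡ sA (st r′ t)
      inputA-≡ : ∀ t → eA (ev r t) ≡ eA (ev r′ t)
      stateB-≡ : ∀ t → sB (st r t) b ≡ sB (st r′ t) b′
      inputB-≡ : ∀ t → eB (ev r t) b ≡ eB (ev r′ t) b′

  module _ {n n′} {r : Run T n} {b} {r′ : Run T n′} {b′} (same : SameObservations r b r′ b′) where
    open SameObservations same

    Sat-⇔ : ∀ t φ → Sat T r b t φ ⇔ Sat T r′ b′ t φ
    Sat-⇔ t (stateA q) = mk⇔ (trans (sym (stateA-≡ t))) (trans (stateA-≡ t))
    Sat-⇔ t (inputA σ) = mk⇔ (trans (sym (inputA-≡ t))) (trans (inputA-≡ t))
    Sat-⇔ t (stateB₁ q) = mk⇔ (trans (sym (stateB-≡ t))) (trans (stateB-≡ t))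
    Sat-⇔ t (inputB₁ σ) = mk⇔ (trans (sym (inputB-≡ t))) (trans (inputB-≡ t))
    Sat-⇔ t true' = mk⇔ id id
    Sat-⇔ t (not' φ) = ¬-cong-⇔ (Sat-⇔ t φ)
    Sat-⇔ t (φ and' ψ) = Sat-⇔ t φ ×-⇔ Sat-⇔ t ψ
    Sat-⇔ t (φ until' ψ) = mk⇔
      (λ (k , t≤k , ψk , φ-before) → k , t≤k , to (Sat-⇔ k ψ) ψk ,
                                       λ j t≤j j<k → to (Sat-⇔ j φ) (φ-before j t≤j j<k))
      (λ (k , t≤k , ψk , φ-before) → k , t≤k , from (Sat-⇔ k ψ) ψk ,
                                       λ j t≤j j<k → from (Sat-⇔ j φ) (φ-before j t≤j j<k))

module SplitB₂ {T : Templates} {k : ℕ} (r : Run T (2 + k))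
               (fair : UncondFair T r) (ini : Initializing T r) where
  open Templates T

  B₂ : Proc T (2 + k)
  B₂ = inj₂ (fs fz)

  stateB₂ : ℕ → Fin QB
  stateB₂ t = sB (st r t) (fs fz)

  inputB₂ : ℕ → Fin ΣB
  inputB₂ t = eB (ev r t) (fs fz)

  Return : ℕ → Set
  Return t = mv r t ≡ B₂ × stateB₂ (suc t) ≡ initB

  return? : Decidable Return
  return? t = (mv r t ≟ₚ B₂) ×-dec (stateB₂ (suc t) ≟ᶠ initB)

  B₂-moves-on-change : ∀ {t} → stateB₂ (suc t) ≢ stateB₂ t → mv r t ≡ B₂
  B₂-moves-on-change {t} changed with mv r t ≟ₚ B₂
  ... | yes moved = moved
  ... | no unmoved = contradiction (inj₂-injective (Step-frame (step r t) B₂ (unmoved ∘ sym))) changed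

  returns-infinitely-often : ∀ t → ∃[ e ] (t ≤ e × Return e)
  returns-infinitely-often t with fair B₂ t
  ... | m , t≤m , moved with stateB₂ (suc m) ≟ᶠ initB
  ...   | yes home = m , t≤m , moved , home
  ...   | no away with ini B₂ (fair B₂) (suc m)
  ...     | u , m<u , home with entry-step (λ j → stateB₂ j ≟ᶠ initB) m<u away (inj₂-injective home)
  ...       | e , m<e , away′ , home′ =
    e , ≤-trans t≤m (<⇒≤ m<e) ,
    B₂-moves-on-change (λ same → away′ (trans (sym same) home′)) , home′

  open Alternation return? returns-infinitely-often

  copy : Bool → Fin (3 + k)
  copy false = fs fz
  copy true = fs (fs fz)

  embed : Bool → Proc T (2 + k) → Proc T (3 + k)
  embed b (inj₁ a) = inj₁ a
  embed b (inj₂ fz) = inj₂ fz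
  embed b (inj₂ (fs fz)) = inj₂ (copy b)
  embed b (inj₂ (fs (fs i))) = inj₂ (fs (fs (fs i)))

  embed-or-idle : ∀ b P → (∃[ p ] P ≡ embed b p) ⊎ P ≡ inj₂ (copy (not b))
  embed-or-idle b (inj₁ a) = inj₁ (inj₁ a , refl)
  embed-or-idle b (inj₂ fz) = inj₁ (inj₂ fz , refl)
  embed-or-idle false (inj₂ (fs fz)) = inj₁ (B₂ , refl)
  embed-or-idle true (inj₂ (fs fz)) = inj₂ refl
  embed-or-idle false (inj₂ (fs (fs fz))) = inj₂ refl
  embed-or-idle true (inj₂ (fs (fs fz))) = inj₁ (B₂ , refl)
  embed-or-idle b (inj₂ (fs (fs (fs i)))) = inj₁ (inj₂ (fs (fs i)) , refl)

  -- An idle copy holds the input B₂ reads right after its next return to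
  -- init_B, when that copy takes over; so its input never changes while idle.
  pendingInput : ℕ → Fin ΣB
  pendingInput t = inputB₂ (suc (nextEvent t))

  roleState : ℕ → Bool → Fin QB
  roleState t idle = if idle then initB else stateB₂ t

  roleInput : ℕ → Bool → Fin ΣB
  roleInput t idle = if idle then pendingInput t else inputB₂ t

  -- Copy c plays B₂ exactly when c ≡ parity t, i.e. when c xor parity t is false.
  copyState : Bool → ℕ → Fin QB
  copyState c t = roleState t (c xor parity t)

  copyInput : Bool → ℕ → Fin ΣB
  copyInput c t = roleInput t (c xor parity t)

  splitB : {X : Set} → (Fin (2 + k) → X) → (Bool → X) → Fin (3 + k) → X
  splitB old copies fz = old fz
  splitB old copies (fs fz) = copies false
  splitB old copies (fs (fs fz)) = copies true
  splitB old copies (fs (fs (fs i))) = old (fs (fs i))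

  splitB-copy : ∀ {X : Set} (old : Fin (2 + k) → X) copies c → splitB old copies (copy c) ≡ copies c
  splitB-copy old copies false = refl
  splitB-copy old copies true = refl

  splitState : ℕ → GState T (3 + k)
  splitState t = gstate (sA (st r t)) (splitB (sB (st r t)) (λ c → copyState c t))

  splitInput : ℕ → GInput T (3 + k)
  splitInput t = ginput (eA (ev r t)) (splitB (eB (ev r t)) (λ c → copyInput c t))

  splitMover : ℕ → Proc T (3 + k)
  splitMover t = embed (parity t) (mv r t)

  -- Right after a return of B₂ both copies are in init_B, so the parity
  -- before the step may be used.
  copyState-suc : ∀ c t → copyState c (suc t) ≡ roleState (suc t) (c xor parity t)
  copyState-suc c t with return? t
  ... | yes (_ , home) = trans (if-else-≡ _ home) (sym (if-else-≡ _ home))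
  ... | no quiet = cong (roleState (suc t) ∘ (c xor_)) (parity-quiet quiet)

  splitState-embed : ∀ t p → loc T (splitState t) (embed (parity t) p) ≡ loc T (st r t) p
  splitState-embed t (inj₁ a) = refl
  splitState-embed t (inj₂ fz) = refl
  splitState-embed t (inj₂ (fs fz)) = cong inj₂ (trans (splitB-copy _ _ (parity t)) (if-xor-same (parity t)))
  splitState-embed t (inj₂ (fs (fs i))) = refl

  splitState-embed-suc : ∀ t p → loc T (splitState (suc t)) (embed (parity t) p) ≡ loc T (st r (suc t)) p
  splitState-embed-suc t (inj₁ a) = refl
  splitState-embed-suc t (inj₂ fz) = refl
  splitState-embed-suc t (inj₂ (fs fz)) = cong inj₂ (begin
    splitB _ _ (copy p)          ≡⟨ splitB-copy _ _ p ⟩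
    copyState p (suc t)          ≡⟨ copyState-suc p t ⟩
    roleState (suc t) (p xor p)  ≡⟨ if-xor-same p ⟩
    stateB₂ (suc t)              ∎)
    where
    open ≡-Reasoning
    p = parity t
  splitState-embed-suc t (inj₂ (fs (fs i))) = refl

  splitState-idle : ∀ t → sB (splitState t) (copy (not (parity t))) ≡ initB
  splitState-idle t = trans (splitB-copy _ _ (not (parity t))) (if-not-xor-same (parity t))

  splitState-idle-suc : ∀ t → sB (splitState (suc t)) (copy (not (parity t))) ≡ initB
  splitState-idle-suc t = begin
    splitB _ _ (copy (not p))        ≡⟨ splitB-copy _ _ (not p) ⟩
    copyState (not p) (suc t)        ≡⟨ copyState-suc (not p) t ⟩
    roleState (suc t) (not p xor p)  ≡⟨ if-not-xor-same p ⟩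
    initB                            ∎
    where
    open ≡-Reasoning
    p = parity t

  splitInput-embed : ∀ t p → inp T (splitInput t) (embed (parity t) p) ≡ inp T (ev r t) p
  splitInput-embed t (inj₁ a) = refl
  splitInput-embed t (inj₂ fz) = refl
  splitInput-embed t (inj₂ (fs fz)) = cong inj₂ (trans (splitB-copy _ _ (parity t)) (if-xor-same (parity t)))
  splitInput-embed t (inj₂ (fs (fs i))) = refl

  splitInput-embed-suc : ∀ t p → p ≢ mv r t →
    inp T (splitInput (suc t)) (embed (parity t) p) ≡ inp T (ev r (suc t)) p
  splitInput-embed-suc t (inj₁ a) _ = refl
  splitInput-embed-suc t (inj₂ fz) _ = refl
  splitInput-embed-suc t (inj₂ (fs fz)) unmoved = cong inj₂ (begin
    splitB _ _ (copy p)          ≡⟨ splitB-copy _ _ p ⟩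
    copyInput p (suc t)          ≡⟨ cong (roleInput (suc t) ∘ (p xor_)) (parity-quiet no-return) ⟩
    roleInput (suc t) (p xor p)  ≡⟨ if-xor-same p ⟩
    inputB₂ (suc t)              ∎)
    where
    open ≡-Reasoning
    p = parity t
    no-return : ¬ Return t
    no-return = unmoved ∘ sym ∘ proj₁
  splitInput-embed-suc t (inj₂ (fs (fs i))) _ = refl

  copyInput-idle-suc : ∀ t → copyInput (not (parity t)) (suc t) ≡ copyInput (not (parity t)) t
  copyInput-idle-suc t with return? t
  ... | yes ret = begin
    copyInput (not p) (suc t)            ≡⟨ cong (roleInput (suc t) ∘ (not p xor_)) (parity-event ret) ⟩
    roleInput (suc t) (not p xor not p)  ≡⟨ if-xor-same (not p) ⟩
    inputB₂ (suc t)                      ≡⟨ cong (inputB₂ ∘ suc) (sym (nextEvent-here ret)) ⟩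
    pendingInput t                       ≡⟨ sym (if-not-xor-same p) ⟩
    copyInput (not p) t                  ∎
    where
    open ≡-Reasoning
    p = parity t
  ... | no quiet = begin
    copyInput (not p) (suc t)        ≡⟨ cong (roleInput (suc t) ∘ (not p xor_)) (parity-quiet quiet) ⟩
    roleInput (suc t) (not p xor p)  ≡⟨ if-not-xor-same p ⟩
    pendingInput (suc t)             ≡⟨ cong (inputB₂ ∘ suc) (nextEvent-quiet quiet) ⟩
    pendingInput t                   ≡⟨ sym (if-not-xor-same p) ⟩
    copyInput (not p) t              ∎
    where
    open ≡-Reasoning
    p = parity t

  splitStart : ∀ P → loc T (splitState 0) P ≡ initOf T P
  splitStart (inj₁ a) = start r (inj₁ a)
  splitStart (inj₂ fz) = start r (inj₂ fz)
  splitStart (inj₂ (fs fz)) = start r B₂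
  splitStart (inj₂ (fs (fs fz))) = refl
  splitStart (inj₂ (fs (fs (fs i)))) = start r (inj₂ (fs (fs i)))

  private
    embedded-non-mover : ∀ {t p} → embed (parity t) p ≢ splitMover t → p ≢ mv r t
    embedded-non-mover ≢mover = ≢mover ∘ cong (embed _)

  splitStep : ∀ t → Step T (splitState t) (splitInput t) (splitMover t) (splitState (suc t))
  splitStep t = step-transfer (step r t) (splitState-embed t (mv r t)) (splitState-embed-suc t (mv r t))
                              (splitInput-embed t (mv r t)) mirrors unchanged
    where
    mirrors : ∀ P → P ≢ splitMover t → MirrorsOrRests (st r t) (mv r t) (splitState t) P
    mirrors P ≢mover with embed-or-idle (parity t) P
    ... | inj₁ (p , refl) = inj₁ (p , embedded-non-mover ≢mover , splitState-embed t p)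
    ... | inj₂ refl = inj₂ (cong inj₂ (splitState-idle t))

    unchanged : ∀ P → P ≢ splitMover t → loc T (splitState (suc t)) P ≡ loc T (splitState t) P
    unchanged P ≢mover with embed-or-idle (parity t) P
    ... | inj₁ (p , refl) = begin
      loc T (splitState (suc t)) (embed (parity t) p) ≡⟨ splitState-embed-suc t p ⟩
      loc T (st r (suc t)) p                          ≡⟨ Step-frame (step r t) p (embedded-non-mover ≢mover) ⟩
      loc T (st r t) p                                ≡⟨ sym (splitState-embed t p) ⟩
      loc T (splitState t) (embed (parity t) p)       ∎
      where open ≡-Reasoning
    ... | inj₂ refl = cong inj₂ (trans (splitState-idle-suc t) (sym (splitState-idle t)))

  splitInput-unchanged : ∀ t P → P ≢ splitMover t → inp T (splitInput (suc t)) P ≡ inp T (splitInput t) P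
  splitInput-unchanged t P ≢mover with embed-or-idle (parity t) P
  ... | inj₁ (p , refl) = begin
    inp T (splitInput (suc t)) (embed (parity t) p) ≡⟨ splitInput-embed-suc t p (embedded-non-mover ≢mover) ⟩
    inp T (ev r (suc t)) p                          ≡⟨ input r t p (embedded-non-mover ≢mover) ⟩
    inp T (ev r t) p                                ≡⟨ sym (splitInput-embed t p) ⟩
    inp T (splitInput t) (embed (parity t) p)       ∎
    where open ≡-Reasoning
  ... | inj₂ refl = cong inj₂ (begin
    splitB _ _ (copy (not (parity t)))  ≡⟨ splitB-copy _ _ (not (parity t)) ⟩
    copyInput (not (parity t)) (suc t)  ≡⟨ copyInput-idle-suc t ⟩
    copyInput (not (parity t)) t        ≡⟨ sym (splitB-copy _ _ (not (parity t))) ⟩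
    splitB _ _ (copy (not (parity t)))  ∎)
    where open ≡-Reasoning

  splitRun : Run T (3 + k)
  splitRun = record
    { st = splitState ; ev = splitInput ; mv = splitMover
    ; start = splitStart ; step = splitStep ; input = splitInput-unchanged }

  private
    moves-as : ∀ {p P} → (∀ b → embed b p ≡ P) → MovesInfOften T r p → MovesInfOften T splitRun P
    moves-as embeds often t with often t
    ... | t′ , t≤t′ , moved = t′ , t≤t′ , trans (cong (embed _) moved) (embeds _)

    copy-moves : ∀ c → MovesInfOften T splitRun (inj₂ (copy c))
    copy-moves c t with event-with-parity c t
    ... | e , t≤e , (moved , _) , parity≡c = e , t≤e , cong₂ embed parity≡c moved

    copy-returns : ∀ c t → ∃[ t′ ] (t ≤ t′ × loc T (splitState t′) (inj₂ (copy c)) ≡ inj₂ initB)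
    copy-returns c t with nextEvent-first t
    ... | t≤e , (_ , home) , _ =
      suc (nextEvent t) , ≤-trans t≤e (n≤1+n _) ,
      cong inj₂ (trans (splitB-copy _ _ c) (if-else-≡ _ home))

  splitFair : UncondFair T splitRun
  splitFair (inj₁ a) = moves-as (λ _ → refl) (fair (inj₁ a))
  splitFair (inj₂ fz) = moves-as (λ _ → refl) (fair (inj₂ fz))
  splitFair (inj₂ (fs fz)) = copy-moves false
  splitFair (inj₂ (fs (fs fz))) = copy-moves true
  splitFair (inj₂ (fs (fs (fs i)))) = moves-as (λ _ → refl) (fair (inj₂ (fs (fs i))))

  splitInitializing : Initializing T splitRun
  splitInitializing (inj₁ a) _ = ini (inj₁ a) (fair (inj₁ a))
  splitInitializing (inj₂ fz) _ = ini (inj₂ fz) (fair (inj₂ fz))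
  splitInitializing (inj₂ (fs fz)) _ = copy-returns false
  splitInitializing (inj₂ (fs (fs fz))) _ = copy-returns true
  splitInitializing (inj₂ (fs (fs (fs i)))) _ = ini (inj₂ (fs (fs i))) (fair (inj₂ (fs (fs i))))

  splitObservations : SameObservations r fz splitRun fz
  splitObservations = record
    { stateA-≡ = λ _ → refl ; inputA-≡ = λ _ → refl
    ; stateB-≡ = λ _ → refl ; inputB-≡ = λ _ → refl }

lemma13 : (T : Templates) (n : ℕ) (n≥2 : 2 ≤ n) (h : LTL T) →
          ∃[ r ] (UncondFair T {n} r × Initializing T r × Sat T r (B₁ n≥2) 0 h) →
          ∃[ r ] (UncondFair T {suc n} r × Initializing T r × Sat T r (B₁ (m≤n⇒m≤1+n n≥2)) 0 h)
lemma13 T (suc (suc k)) (s≤s (s≤s z≤n)) h (r , fair , ini , sat) =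
  splitRun , splitFair , splitInitializing , to (Sat-⇔ splitObservations 0 h) sat
  where open SplitB₂ r fair ini
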